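{- Let $m$ be a positive integer and $M=[0,m]\subset\mathbb{R}$. Then every maximal system of brick islands in $M$ has exactly $m$ elements. In particular $g_1(m)=m$.
   Context: A brick of $[0,m]$ is an interval $[a,b]$ with $a,b\in\mathbb{Z}$, $0\le a<b\le m$. A system of brick islands in $M$ is a set $H$ of such intervals any two of which are nested or disjoint; it is maximal if it is not properly contained in another such system. $g_1(m)$ is the minimum cardinality of a maximal system of brick islands in $[0,m]$. -}

module Defs where

open import Data.Nat using (ℕ; _≤_; _<_)
open import Relation.Binary.PropositionalEquality using (_≡_)
open import Data.Product using (_×_; ∃-syntax)
open import Data.Sum using (_⊎_)
open import Data.List using (List; length)
open import Data.List.Membership.Propositional using (_∈_)
open import Data.List.Relation.Binary.Subset.Propositional using (_⊆_)
open import Data.List.Relation.Unary.Unique.Propositional using (Unique)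

-- An interval [a,b] with integer endpoints, stored as the pair (a , b).
record Interval : Set where
  constructor ⟦_,_⟧
  field
    lo : ℕ
    hi : ℕ
open Interval public

IsBrick : ℕ → Interval → Set
IsBrick m I = lo I < hi I × hi I ≤ m

-- [a,b] ⊆ [c,d] as subsets of ℝ (for nonempty intervals)
_⊑_ : Interval → Interval → Set
I ⊑ J = lo J ≤ lo I × hi I ≤ hi J

-- closed intervals [a,b], [c,d] are disjoint subsets of ℝ: b < c or d < a
Disjoint : Interval → Interval → Set
Disjoint I J = hi I < lo J ⊎ hi J < lo I

NestedOrDisjoint : Interval → Interval → Set
NestedOrDisjoint I J = I ⊑ J ⊎ J ⊑ I ⊎ Disjoint I J

-- A finite set of intervals is represented by a duplicate-free list.
-- A system of brick islands in [0,m]: a set of bricks, any two nested or disjoint.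
record IsSystem (m : ℕ) (H : List Interval) : Set where
  field
    unique  : Unique H
    bricks  : ∀ {I} → I ∈ H → IsBrick m I
    laminar : ∀ {I J} → I ∈ H → J ∈ H → NestedOrDisjoint I J

IsMaximal : ℕ → List Interval → Set
IsMaximal m H = IsSystem m H × (∀ H' → IsSystem m H' → H ⊆ H' → H' ⊆ H)

card : List Interval → ℕ
card = length

-- g₁(m) = k : k is the minimum cardinality of a maximal system in [0,m]
G₁≡ : ℕ → ℕ → Set
G₁≡ m k = (∃[ H ] (IsMaximal m H × card H ≡ k)) × (∀ H → IsMaximal m H → k ≤ card H)

module Submission where

-- Idea: split [0,m] into the m unit cells [j,j+1], 0 ≤ j < m.  In a maximal
-- system H the whole interval [0,m] is a member, so every cell j has an
-- *owner*: the ⊑-least member of H containing it (members sharing a cell are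
-- nested, so the least one exists and is unique).  The owner map
-- cells → H is a bijection:
--   * injective: if I owned two cells j < j', the truncation [lo I, j'] could
--     be added to H without breaking laminarity, so by maximality it is a
--     member; it contains j and is strictly shorter than I, contradicting
--     that I owns j;
--   * surjective: sweeping I from left to right, either some cell of I lies in
--     no proper sub-interval of I from H (and I owns that cell), or a proper
--     sub-interval of H starting at lo I would reach hi I, which is absurd.
-- Hence card H = m.  The staircase {[0,1], [0,2], …, [0,m]} is a maximal
-- system of size m, so the minimum g₁(m) is attained and equals m.

open import Defs
open import Data.Nat using (ℕ; zero; suc; _+_; _∸_; _≤_; _<_; _≥_; z≤n; s≤s; _≤?_; _<?_; _≟_)
open import Data.Nat.Properties
open import Data.Product using (_×_; _,_; proj₁; proj₂; ∃-syntax)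
open import Data.Sum using (_⊎_; inj₁; inj₂)
open import Data.List using (List; []; _∷_; map; length; allFin)
open import Data.List.Properties using (length-map; length-tabulate)
open import Data.List.Membership.Propositional using (_∈_; find; lose)
open import Data.List.Relation.Binary.Subset.Propositional using (_⊆_)
open import Data.List.Membership.Propositional.Properties using (∈-map⁺; ∈-map⁻; ∈-allFin)
open import Data.List.Membership.Propositional.Properties.WithK using (unique∧set⇒bag)
open import Data.List.Relation.Binary.BagAndSetEquality using (∼bag⇒↭)
open import Data.List.Relation.Binary.Permutation.Propositional.Properties using (↭-length)
open import Data.List.Relation.Unary.Any using (Any; here; there; any?)
open import Data.List.Relation.Unary.All using (tabulate)
open import Data.List.Relation.Unary.AllPairs using ([]; _∷_)
open import Data.List.Relation.Unary.Unique.Propositional using (Unique)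
open import Data.List.Relation.Unary.Unique.Propositional.Properties using (map⁺; allFin⁺)
open import Data.Fin using (Fin; toℕ; fromℕ<)
open import Data.Fin.Properties using (toℕ-injective; toℕ<n; toℕ-fromℕ<)
open import Data.Empty using (⊥-elim)
open import Relation.Nullary using (Dec; yes; no; ¬_)
open import Relation.Nullary.Decidable using (_×-dec_; _⊎-dec_)
open import Relation.Binary.Definitions using (tri<; tri≈; tri>)
open import Relation.Binary.PropositionalEquality using (_≡_; refl; sym; trans; cong; cong₂; subst)
open import Function.Bundles using (mk⇔)
open import Function.Definitions using (Injective)

length-of-enumeration : ∀ {a} {A : Set a} {xs : List A} {n} (f : Fin n → A) →
  Injective _≡_ _≡_ f → Unique xs → (∀ i → f i ∈ xs) → (∀ {x} → x ∈ xs → ∃[ i ] f i ≡ x) →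
  length xs ≡ n
length-of-enumeration {xs = xs} {n} f f-inj xs-unique f-into f-onto =
  trans (↭-length (∼bag⇒↭ (unique∧set⇒bag xs-unique (map⁺ f-inj (allFin⁺ n)) (mk⇔ to from))))
        (trans (length-map f (allFin n)) (length-tabulate (λ i → i)))
  where
  to : ∀ {x} → x ∈ xs → x ∈ map f (allFin n)
  to x∈xs with f-onto x∈xs
  ... | i , refl = ∈-map⁺ f (∈-allFin i)
  from : ∀ {x} → x ∈ map f (allFin n) → x ∈ xs
  from x∈image with ∈-map⁻ f x∈image
  ... | i , _ , refl = f-into i

-- Intervals.  I ∋ᶜ j says that I contains the unit cell [j, j+1].
_∋ᶜ_ : Interval → ℕ → Set
I ∋ᶜ j = lo I ≤ j × j < hi I

_∋ᶜ?_ : ∀ I j → Dec (I ∋ᶜ j)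
I ∋ᶜ? j = (lo I ≤? j) ×-dec (j <? hi I)

_⊏_ : Interval → Interval → Set
J ⊏ I = J ⊑ I × (lo I < lo J ⊎ hi J < hi I)

_⊏?_ : ∀ J I → Dec (J ⊏ I)
J ⊏? I = ((lo I ≤? lo J) ×-dec (hi J ≤? hi I)) ×-dec ((lo I <? lo J) ⊎-dec (hi J <? hi I))

⊑-refl : ∀ {I} → I ⊑ I
⊑-refl = ≤-refl , ≤-refl

⊑-trans : ∀ {I J K} → I ⊑ J → J ⊑ K → I ⊑ K
⊑-trans (p , q) (r , s) = ≤-trans r p , ≤-trans q s

⊑-antisym : ∀ {I J} → I ⊑ J → J ⊑ I → I ≡ J
⊑-antisym (p , q) (r , s) = cong₂ ⟦_,_⟧ (≤-antisym r p) (≤-antisym q s)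

⊑-not-proper : ∀ {J I} → J ⊑ I → ¬ J ⊏ I → I ⊑ J
⊑-not-proper {J} {I} J⊑I not-proper with lo I <? lo J | hi J <? hi I
... | yes p | _     = ⊥-elim (not-proper (J⊑I , inj₁ p))
... | no _  | yes p = ⊥-elim (not-proper (J⊑I , inj₂ p))
... | no p  | no q  = ≮⇒≥ p , ≮⇒≥ q

nested-or-disjoint-sym : ∀ {I J} → NestedOrDisjoint I J → NestedOrDisjoint J I
nested-or-disjoint-sym (inj₁ p)               = inj₂ (inj₁ p)
nested-or-disjoint-sym (inj₂ (inj₁ p))        = inj₁ p
nested-or-disjoint-sym (inj₂ (inj₂ (inj₁ p))) = inj₂ (inj₂ (inj₂ p))
nested-or-disjoint-sym (inj₂ (inj₂ (inj₂ p))) = inj₂ (inj₂ (inj₁ p))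

_≟ᴵ_ : (I J : Interval) → Dec (I ≡ J)
⟦ a , b ⟧ ≟ᴵ ⟦ c , d ⟧ with a ≟ c | b ≟ d
... | yes refl | yes refl = yes refl
... | no a≢c   | _        = no λ { refl → a≢c refl }
... | _        | no b≢d   = no λ { refl → b≢d refl }

open import Data.List.Membership.DecPropositional _≟ᴵ_ using (_∈?_)

nested-on-cell : ∀ {m H} → IsSystem m H → ∀ {j I J} → I ∈ H → J ∈ H →
  I ∋ᶜ j → J ∋ᶜ j → I ⊑ J ⊎ J ⊑ I
nested-on-cell sys I∈H J∈H (a , b) (c , d) with IsSystem.laminar sys I∈H J∈H
... | inj₁ I⊑J              = inj₁ I⊑J
... | inj₂ (inj₁ J⊑I)       = inj₂ J⊑I
... | inj₂ (inj₂ (inj₁ p))  = ⊥-elim (<⇒≱ (<-trans b p) c)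
... | inj₂ (inj₂ (inj₂ p))  = ⊥-elim (<⇒≱ (<-trans d p) a)

cell-below : ∀ {m H} → IsSystem m H → ∀ {I j} → I ∈ H → I ∋ᶜ j → j < m
cell-below sys I∈H (_ , j<hi) = <-≤-trans j<hi (proj₂ (IsSystem.bricks sys I∈H))

maximal-absorbs : ∀ {m H X} → IsMaximal m H → IsBrick m X →
  (∀ {J} → J ∈ H → NestedOrDisjoint X J) → X ∈ H
maximal-absorbs {m} {H} {X} (sys , maximal) X-brick X-compatible with X ∈? H
... | yes X∈H = X∈H
... | no X∉H  = ⊥-elim (X∉H (maximal (X ∷ H) extended there (here refl)))
  where
  open IsSystem sys
  extended : IsSystem m (X ∷ H)
  extended = record
    { unique  = tabulate (λ J∈H X≡J → X∉H (subst (_∈ H) (sym X≡J) J∈H)) ∷ unique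
    ; bricks  = λ { (here refl) → X-brick ; (there J∈H) → bricks J∈H }
    ; laminar = λ { (here refl) (here refl) → inj₁ ⊑-refl
                  ; (here refl) (there J∈H) → X-compatible J∈H
                  ; (there I∈H) (here refl) → nested-or-disjoint-sym (X-compatible I∈H)
                  ; (there I∈H) (there J∈H) → laminar I∈H J∈H } }

whole-∈ : ∀ {m H} → IsMaximal m H → 1 ≤ m → ⟦ 0 , m ⟧ ∈ H
whole-∈ H-max 1≤m = maximal-absorbs H-max (1≤m , ≤-refl)
  λ J∈H → inj₂ (inj₁ (z≤n , proj₂ (IsSystem.bricks (proj₁ H-max) J∈H)))

Owns : List Interval → ℕ → Interval → Set
Owns H j I = I ∈ H × I ∋ᶜ j × (∀ {J} → J ∈ H → J ∋ᶜ j → I ⊑ J)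

owner-unique : ∀ {H j I I'} → Owns H j I → Owns H j I' → I ≡ I'
owner-unique (I∈H , I∋j , I-least) (I'∈H , I'∋j , I'-least) =
  ⊑-antisym (I-least I'∈H I'∋j) (I'-least I∈H I∋j)

least-containing : ∀ {m H} → IsSystem m H → ∀ j (xs : List Interval) →
  (∀ {x} → x ∈ xs → x ∈ H) → ∀ {I₀} → I₀ ∈ H → I₀ ∋ᶜ j →
  ∃[ I ] (I ∈ H × I ∋ᶜ j × (∀ {J} → J ∈ xs → J ∋ᶜ j → I ⊑ J))
least-containing sys j [] _ I₀∈H I₀∋j = _ , I₀∈H , I₀∋j , λ ()
least-containing sys j (x ∷ xs) xs⊆H I₀∈H I₀∋j
  with least-containing sys j xs (λ x∈xs → xs⊆H (there x∈xs)) I₀∈H I₀∋j | x ∋ᶜ? j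
... | I , I∈H , I∋j , I-least | no x∌j =
  I , I∈H , I∋j , λ { (here refl) x∋j → ⊥-elim (x∌j x∋j) ; (there J∈xs) → I-least J∈xs }
... | I , I∈H , I∋j , I-least | yes x∋j with nested-on-cell sys I∈H (xs⊆H (here refl)) I∋j x∋j
...   | inj₁ I⊑x = I , I∈H , I∋j , λ { (here refl) _ → I⊑x ; (there J∈xs) → I-least J∈xs }
...   | inj₂ x⊑I = x , xs⊆H (here refl) , x∋j ,
        λ { (here refl) _ → ⊑-refl ; (there J∈xs) J∋j → ⊑-trans x⊑I (I-least J∈xs J∋j) }

owner-exists : ∀ {m H} → IsMaximal m H → ∀ j → j < m → ∃[ I ] Owns H j I
owner-exists H-max j j<m =
  least-containing (proj₁ H-max) j _ (λ x∈H → x∈H) (whole-∈ H-max (≤-<-trans z≤n j<m)) (z≤n , j<m)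

-- If I owns j and j' with j < j', the truncation [lo I, j']
-- is compatible with every member J: this is checked by the position of J
-- relative to I, using that I is the least member containing j'.
truncation-compatible : ∀ {m H j' I} → IsSystem m H → Owns H j' I →
  ∀ {J} → J ∈ H → NestedOrDisjoint ⟦ lo I , j' ⟧ J
truncation-compatible {j' = j'} sys (I∈H , (_ , j'<hi) , I-least) {J} J∈H
  with IsSystem.laminar sys I∈H J∈H
... | inj₁ (p , q)          = inj₁ (p , ≤-trans (<⇒≤ j'<hi) q)
... | inj₂ (inj₂ (inj₁ p))  = inj₂ (inj₂ (inj₁ (<-trans j'<hi p)))
... | inj₂ (inj₂ (inj₂ p))  = inj₂ (inj₂ (inj₂ p))
... | inj₂ (inj₁ (p , q)) with hi J ≤? j' | lo J ≤? j'
...   | yes hi≤j' | _        = inj₂ (inj₁ (p , hi≤j'))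
...   | no hi≰j'  | yes lo≤j' =
        inj₁ (proj₁ (I-least J∈H (lo≤j' , ≰⇒> hi≰j')) , <⇒≤ (≰⇒> hi≰j'))
...   | no _      | no lo≰j' = inj₂ (inj₂ (inj₁ (≰⇒> lo≰j')))

no-two-owned-cells : ∀ {m H j j' I} → IsMaximal m H → Owns H j I → Owns H j' I → ¬ j < j'
no-two-owned-cells H-max (I∈H , (lo≤j , _) , I-least) owns-j' j<j' =
  <⇒≱ (proj₂ (proj₁ (proj₂ owns-j'))) (proj₂ (I-least truncation∈H (lo≤j , j<j')))
  where
  sys = proj₁ H-max
  truncation∈H = maximal-absorbs H-max
    (≤-<-trans lo≤j j<j' , ≤-trans (<⇒≤ (proj₂ (proj₁ (proj₂ owns-j')))) (proj₂ (IsSystem.bricks sys I∈H)))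
    (truncation-compatible sys owns-j')

owned-cells-equal : ∀ {m H j j' I} → IsMaximal m H → Owns H j I → Owns H j' I → j ≡ j'
owned-cells-equal {j = j} {j'} H-max owns-j owns-j' with <-cmp j j'
... | tri< j<j' _ _ = ⊥-elim (no-two-owned-cells H-max owns-j owns-j' j<j')
... | tri≈ _ j≡j' _ = j≡j'
... | tri> _ _ j'<j = ⊥-elim (no-two-owned-cells H-max owns-j' owns-j j'<j)

Covered : List Interval → Interval → ℕ → Set
Covered H I j = Any (λ J → J ⊏ I × J ∋ᶜ j) H

covered? : ∀ H I j → Dec (Covered H I j)
covered? H I j = any? (λ J → (J ⊏? I) ×-dec (J ∋ᶜ? j)) H

uncovered⇒owned : ∀ {m H I j} → IsSystem m H → I ∈ H → I ∋ᶜ j → ¬ Covered H I j → Owns H j I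
uncovered⇒owned {H = H} {I} {j} sys I∈H I∋j uncovered = I∈H , I∋j , I-least
  where
  I-least : ∀ {J} → J ∈ H → J ∋ᶜ j → I ⊑ J
  I-least J∈H J∋j with nested-on-cell sys I∈H J∈H I∋j J∋j
  ... | inj₁ I⊑J = I⊑J
  ... | inj₂ J⊑I = ⊑-not-proper J⊑I λ J⊏I → uncovered (lose J∈H (J⊏I , J∋j))

-- State of the left-to-right sweep of I after cell t: either an uncovered
-- cell of I has been found, or a proper sub-interval J ∈ H starting at lo I
-- contains all cells up to t.
Sweep : List Interval → Interval → ℕ → Set
Sweep H I t = (∃[ j ] (I ∋ᶜ j × ¬ Covered H I j))
            ⊎ (∃[ J ] (J ∈ H × J ⊏ I × lo J ≤ lo I × t < hi J))

sweep-start : ∀ H I → lo I < hi I → Sweep H I (lo I)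
sweep-start H I lo<hi with covered? H I (lo I)
... | no uncovered = inj₁ (lo I , (≤-refl , lo<hi) , uncovered)
... | yes covered with find covered
...   | J , J∈H , J⊏I , (lo≤ , <hi) = inj₂ (J , J∈H , J⊏I , lo≤ , <hi)

-- When the current sub-interval J stops at t + 1, a covering interval J₂ of
-- the cell t + 1 must overlap J, hence (by laminarity) contain it and extend
-- further right while still starting at lo I.
sweep-step : ∀ {m H I} → IsSystem m H → ∀ t → lo I ≤ t → suc t < hi I → Sweep H I t → Sweep H I (suc t)
sweep-step sys t lo≤t t+1<hi (inj₁ found) = inj₁ found
sweep-step {H = H} {I} sys t lo≤t t+1<hi (inj₂ (J , J∈H , J⊏I , J-start , t<hiJ)) with suc t <? hi J
... | yes t+1<hiJ = inj₂ (J , J∈H , J⊏I , J-start , t+1<hiJ)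
... | no t+1≮hiJ with covered? H I (suc t)
...   | no uncovered = inj₁ (suc t , (m≤n⇒m≤1+n lo≤t , t+1<hi) , uncovered)
...   | yes covered with find covered
...     | J₂ , J₂∈H , J₂⊏I , (lo₂≤ , t+1<hi₂) with IsSystem.laminar sys J∈H J₂∈H
...       | inj₁ (p , _)         = inj₂ (J₂ , J₂∈H , J₂⊏I , ≤-trans p J-start , t+1<hi₂)
...       | inj₂ (inj₁ (_ , q))  = ⊥-elim (<⇒≱ t+1<hi₂ (≤-trans q (≮⇒≥ t+1≮hiJ)))
...       | inj₂ (inj₂ (inj₁ p)) = ⊥-elim (<⇒≱ (≤-<-trans t<hiJ p) lo₂≤)
...       | inj₂ (inj₂ (inj₂ p)) =
            ⊥-elim (<⇒≱ (<-≤-trans p (≤-trans J-start lo≤t)) (<⇒≤ (<-trans (n<1+n t) t+1<hi₂)))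

sweep : ∀ {m H I} → IsSystem m H → lo I < hi I → ∀ k → k + lo I < hi I → Sweep H I (k + lo I)
sweep {H = H} {I} sys lo<hi zero    _       = sweep-start H I lo<hi
sweep {I = I}     sys lo<hi (suc k) k+1+lo<hi =
  sweep-step sys (k + lo I) (m≤n+m (lo I) k) k+1+lo<hi (sweep sys lo<hi k (<-trans (n<1+n _) k+1+lo<hi))

-- Completing the sweep: no proper sub-interval reaches hi I, so every member
-- of a system has an uncovered cell, which it owns.
owns-some-cell : ∀ {m H I} → IsSystem m H → I ∈ H → ∃[ j ] Owns H j I
owns-some-cell {H = H} {I} sys I∈H = finish (sweep sys lo<hi k (subst (k + lo I <_) k+lo+1≡hi (n<1+n _)))
  where
  lo<hi = proj₁ (IsSystem.bricks sys I∈H)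
  k = hi I ∸ suc (lo I)
  k+lo+1≡hi : suc (k + lo I) ≡ hi I
  k+lo+1≡hi = trans (sym (+-suc k (lo I))) (m∸n+n≡m lo<hi)
  finish : Sweep H I (k + lo I) → ∃[ j ] Owns H j I
  finish (inj₁ (j , I∋j , uncovered)) = j , uncovered⇒owned sys I∈H I∋j uncovered
  finish (inj₂ (J , _ , (_ , inj₁ lo<loJ) , J-start , _)) = ⊥-elim (<⇒≱ lo<loJ J-start)
  finish (inj₂ (J , _ , (_ , inj₂ hiJ<hi) , _ , last<hiJ)) =
    ⊥-elim (<⇒≱ hiJ<hi (subst (_≤ hi J) k+lo+1≡hi last<hiJ))

module OwnerMap {m H} (H-max : IsMaximal m H) where

  owner : Fin m → Interval
  owner i = proj₁ (owner-exists H-max (toℕ i) (toℕ<n i))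

  owner-owns : ∀ i → Owns H (toℕ i) (owner i)
  owner-owns i = proj₂ (owner-exists H-max (toℕ i) (toℕ<n i))

  owner-injective : Injective _≡_ _≡_ owner
  owner-injective {i} {i'} owner-i≡owner-i' = toℕ-injective
    (owned-cells-equal H-max (owner-owns i) (subst (Owns H (toℕ i')) (sym owner-i≡owner-i') (owner-owns i')))

  owner-onto : ∀ {I} → I ∈ H → ∃[ i ] owner i ≡ I
  owner-onto I∈H with owns-some-cell (proj₁ H-max) I∈H
  ... | j , owns-j = fromℕ< j<m ,
        owner-unique (subst (λ k → Owns H k (owner (fromℕ< j<m))) (toℕ-fromℕ< j<m) (owner-owns (fromℕ< j<m))) owns-j
    where
    j<m : j < m
    j<m = cell-below (proj₁ H-max) I∈H (proj₁ (proj₂ owns-j))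

maximal-card : ∀ {m H} → IsMaximal m H → card H ≡ m
maximal-card H-max = length-of-enumeration owner owner-injective
  (IsSystem.unique (proj₁ H-max)) (λ i → proj₁ (owner-owns i)) owner-onto
  where open OwnerMap H-max

staircase : ℕ → List Interval
staircase zero    = []
staircase (suc n) = ⟦ 0 , suc n ⟧ ∷ staircase n

staircase-length : ∀ n → length (staircase n) ≡ n
staircase-length zero    = refl
staircase-length (suc n) = cong suc (staircase-length n)

staircase-member : ∀ {n J} → J ∈ staircase n → lo J ≡ 0 × 0 < hi J × hi J ≤ n
staircase-member {suc n} (here refl) = refl , s≤s z≤n , ≤-refl
staircase-member {suc n} (there J∈) with staircase-member J∈
... | lo≡0 , 0<hi , hi≤n = lo≡0 , 0<hi , m≤n⇒m≤1+n hi≤n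

staircase-contains : ∀ n {J} → lo J ≡ 0 → 0 < hi J → hi J ≤ n → J ∈ staircase n
staircase-contains zero    _    0<hi hi≤0 = ⊥-elim (<⇒≱ 0<hi hi≤0)
staircase-contains (suc n) {J} lo≡0 0<hi hi≤n+1 with hi J ≟ suc n
... | yes hi≡n+1 = here (cong₂ ⟦_,_⟧ lo≡0 hi≡n+1)
... | no hi≢n+1  = there (staircase-contains n lo≡0 0<hi (≤-pred (≤∧≢⇒< hi≤n+1 hi≢n+1)))

staircase-system : ∀ n → IsSystem n (staircase n)
staircase-system n = record { unique = unique n ; bricks = bricks ; laminar = laminar }
  where
  unique : ∀ n → Unique (staircase n)
  unique zero    = []
  unique (suc n) = tabulate (λ { J∈ refl → 1+n≰n (proj₂ (proj₂ (staircase-member J∈))) }) ∷ unique n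
  bricks : ∀ {J} → J ∈ staircase n → IsBrick n J
  bricks {J} J∈ with staircase-member J∈
  ... | lo≡0 , 0<hi , hi≤n = subst (_< hi J) (sym lo≡0) 0<hi , hi≤n
  laminar : ∀ {I J} → I ∈ staircase n → J ∈ staircase n → NestedOrDisjoint I J
  laminar {I} {J} I∈ J∈ with staircase-member I∈ | staircase-member J∈ | ≤-total (hi I) (hi J)
  ... | loI≡0 , _ | loJ≡0 , _ | inj₁ hiI≤hiJ = inj₁ (subst (_≤ lo I) (sym loJ≡0) z≤n , hiI≤hiJ)
  ... | loI≡0 , _ | loJ≡0 , _ | inj₂ hiJ≤hiI = inj₂ (inj₁ (subst (_≤ lo J) (sym loI≡0) z≤n , hiJ≤hiI))

-- Maximality: a brick J of a larger system either starts at 0 (and is a step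
-- of the staircase) or meets the step [0, lo J] only in the point lo J.
staircase-maximal : ∀ n → IsMaximal n (staircase n)
staircase-maximal n = staircase-system n , extension-within
  where
  extension-within : ∀ H → IsSystem n H → staircase n ⊆ H → H ⊆ staircase n
  extension-within H H-sys staircase⊆H {J} J∈H with IsSystem.bricks H-sys J∈H | lo J ≟ 0
  ... | lo<hi , hi≤n | yes lo≡0 = staircase-contains n lo≡0 (subst (_< hi J) lo≡0 lo<hi) hi≤n
  ... | lo<hi , hi≤n | no lo≢0
    with IsSystem.laminar H-sys (staircase⊆H (staircase-contains n {⟦ 0 , lo J ⟧} refl (n≢0⇒n>0 lo≢0)
                                  (≤-trans (<⇒≤ lo<hi) hi≤n))) J∈H
  ...   | inj₁ (lo≤0 , _)      = ⊥-elim (lo≢0 (n≤0⇒n≡0 lo≤0))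
  ...   | inj₂ (inj₁ (_ , hi≤lo)) = ⊥-elim (<⇒≱ lo<hi hi≤lo)
  ...   | inj₂ (inj₂ (inj₁ lo<lo)) = ⊥-elim (<-irrefl refl lo<lo)
  ...   | inj₂ (inj₂ (inj₂ hi<0))  = ⊥-elim (<⇒≱ hi<0 z≤n)

lemma1 : (m : ℕ) → m ≥ 1 →
    (∀ (H : List Interval) → IsMaximal m H → card H ≡ m) × G₁≡ m m
lemma1 m _ =
  (λ H H-max → maximal-card H-max) ,
  (staircase m , staircase-maximal m , staircase-length m) ,
  (λ H H-max → ≤-reflexive (sym (maximal-card H-max)))
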